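{- Let $P,P_1,\dots,P_n$ be negative propositional formulas and $A_1,\dots,A_m$ simply universal formulas of arithmetic, and let $\Gamma = z_1:P_1,\dots,z_n:P_n,\ a_1:\forall\alpha_1A_1,\dots,a_m:\forall\alpha_mA_m$. Suppose $\Gamma\vdash t:\exists\alpha\,P$ or $\Gamma\vdash t:P$ in $\mathsf{HA}+\mathsf{EM}_1^-$, with $t$ in normal form and all free variables of $t$ among $z_1,\dots,z_n,a_1,\dots,a_m$. Then: (1) every occurrence in $t$ of a term $\mathsf{H}_{a_i}^{\alpha_iA_i}$ is of the form $\mathsf{H}_{a_i}^{\alpha_iA_i}m$ for some term $m$ of $\mathcal{L}$; (2) $t$ is not of the form $u\parallel_a v$.
   Context: The language $\mathcal{L}$: terms are variables, $0$, and $\mathsf{S}(t)$ (numerals are $\mathsf{S}\cdots\mathsf{S}0$); there is a predicate symbol $\mathcal{P}$ for every primitive recursive relation on $\mathbb{N}$, with $\mathcal{P}^\bot$ the symbol of its complement; atomic formulas are $\mathcal{P}(t_1,\dots,t_n)$, and $\mathcal{P}(\vec t)^\bot:=\mathcal{P}^\bot(\vec t)$. Formulas are built with $\land,\lor,\rightarrow,\forall,\exists$ over natural numbers. A propositional formula is quantifier-free; negative if $\lor$ does not occur; simply universal if of the form $\forall\vec\alpha\,P$ with $P$ negative propositional. Proof terms of $\mathsf{HA}+\mathsf{EM}_1^-$: $x\mid tu\mid tm\mid\lambda x.u\mid\lambda\alpha.u\mid\langle t,u\rangle\mid\pi_0u\mid\pi_1u\mid\iota_0(u)\mid\iota_1(u)\mid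 t[x.u,y.v]\mid(m,t)\mid t[(\alpha,x).u]\mid(u\parallel_a v)\mid\mathsf{H}_a^{\alpha P}\mid\mathsf{W}_a^{\alpha P}\mid\mathsf{True}\mid\mathsf{R}uvm\mid\mathsf{r}t_1\dots t_n$. Typing: the usual intuitionistic Curry–Howard rules ($\Gamma,x:A\vdash x:A$; pairing/projections for $\land$; $\lambda$/application for $\rightarrow$; $\iota_i$ and $u[x.w_1,y.w_2]$ for $\lor$; $\lambda\alpha.u$ ($\alpha$ not free in $\Gamma$) and $um:A[m/\alpha]$ for $\forall$; $(m,u):\exists\alpha A$ from $u:A[m/\alpha]$ and $u[(\alpha,x).t]:C$ from $u:\exists\alpha A$, $\Gamma,x:A\vdash t:C$ ($\alpha$ not free in $C,\Gamma$) for $\exists$); axioms $\Gamma,a:\forall\alpha P\vdash\mathsf{H}_a^{\alpha P}:\forall\alpha P$ and $\Gamma,a:\exists\alpha P^\bot\vdash\mathsf{W}_a^{\alpha P}:\exists\alpha P^\bot$; induction: from $u:A(0)$ and $v:\forall\alpha(A(\alpha)\rightarrow A(\mathsf{S}\alpha))$ infer $\mathsf{R}uvm:A[m/\alpha]$; Post rules: from $u_i:A_i$ ($i=1..n$) infer $\mathsf{r}u_1\dots u_n:A$ (or $\mathsf{True}:A$ if $n=0$) whenever $A_1,\dots,A_n,A$ atomic and the inference is a Post rule for equality, Peano axioms, classical propositional tautologies or booleans; $\mathsf{EM}_1^-$: from $\Gamma,a:\forall\alpha P\vdash u:\exists\beta Q$ and $\Gamma,a:\exists\alpha P^\bot\vdash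 v:\exists\beta Q$ ($P$ atomic, $Q$ negative propositional) infer $\Gamma\vdash(u\parallel_a v):\exists\beta Q$, where $a$ occurs free in $u$ only within $\mathsf{H}_a^{\alpha P}$ and in $v$ only within $\mathsf{W}_a^{\alpha P}$. Reduction rules (on any subterm): $(\lambda x.u)t\mapsto u[t/x]$; $(\lambda\alpha.u)m\mapsto u[m/\alpha]$; $\pi_i\langle u_0,u_1\rangle\mapsto u_i$; $\iota_i(u)[x_0.t_0,x_1.t_1]\mapsto t_i[u/x_i]$; $(m,u)[(\alpha,x).v]\mapsto v[m/\alpha][u/x]$; $\mathsf{R}uv0\mapsto u$; $\mathsf{R}uv(\mathsf{S}n)\mapsto vn(\mathsf{R}uvn)$ for numerals $n$; $u\parallel_a v\mapsto u$ if $a$ is not free in $u$; $u\parallel_a v\mapsto v[a:=n]$ if $\mathsf{H}_a^{\alpha P}n$ occurs in $u$, $P[n/\alpha]$ is closed and false, where $v[a:=n]$ replaces each free $\mathsf{W}_a^{\alpha P}$ in $v$ by $(n,\mathsf{True})$; $\mathsf{H}_a^{\alpha P}n\mapsto\mathsf{True}$ if $P[n/\alpha]$ is closed and true. Normal form means no redex occurs. -}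

module Defs where

open import Data.Nat using (ℕ; zero; suc; _≟_)
open import Data.Fin using (Fin)
open import Data.Vec using (Vec; []; _∷_; lookup)
import Data.Vec as Vec
open import Data.List using (List; []; _∷_; _++_; map; reverse; filter)
open import Data.Bool using (Bool; true; false; not)
open import Data.Product using (Σ; _×_; _,_; proj₁; proj₂)
open import Relation.Binary.PropositionalEquality using (_≡_; _≢_)
open import Relation.Nullary using (¬_; ¬?)
open import Data.List.Membership.Propositional using (_∉_)
open import Data.List.Relation.Binary.Subset.Propositional using (_⊆_)

-- A predicate symbol is a code f of a primitive recursive function of
-- arity k together with a polarity b:
--   polarity true  : the relation  { xs | f xs = 0 }
--   polarity false : its complement { xs | f xs ≠ 0 }
-- Every primitive recursive relation arises in this way, and flipping the
-- polarity gives the symbol of the complement.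

data PR : ℕ → Set where
  zer   : PR 0
  succ  : PR 1
  proj  : ∀ {k} → Fin k → PR k
  comp  : ∀ {k m} → PR m → Vec (PR k) m → PR k
  prec  : ∀ {k} → PR k → PR (suc (suc k)) → PR (suc k)

mutual
  eval : ∀ {k} → PR k → Vec ℕ k → ℕ
  eval zer [] = 0
  eval succ (x ∷ []) = suc x
  eval (proj i) xs = lookup xs i
  eval (comp f gs) xs = eval f (evals gs xs)
  eval (prec g h) (n ∷ xs) = evalRec g h n xs

  evals : ∀ {k m} → Vec (PR k) m → Vec ℕ k → Vec ℕ m
  evals [] xs = []
  evals (g ∷ gs) xs = eval g xs ∷ evals gs xs

  evalRec : ∀ {k} → PR k → PR (suc (suc k)) → ℕ → Vec ℕ k → ℕ
  evalRec g h zero xs = eval g xs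
  evalRec g h (suc n) xs = eval h (n ∷ evalRec g h n xs ∷ xs)

data Tm : Set where
  var : ℕ → Tm
  `0  : Tm
  S   : Tm → Tm

data Numeral : Tm → Set where
  nz : Numeral `0
  ns : ∀ {t} → Numeral t → Numeral (S t)

infixr 6 _∧'_
infixr 5 _∨'_
infixr 4 _⇒_

data Fm : Set where
  atom : (k : ℕ) → PR k → Bool → Vec Tm k → Fm
  _∧'_ : Fm → Fm → Fm
  _∨'_ : Fm → Fm → Fm
  _⇒_  : Fm → Fm → Fm
  ∀'   : Fm → Fm      -- binds de Bruijn index 0
  ∃'   : Fm → Fm      -- binds de Bruijn index 0

_ᗮ : Fm → Fm
atom k f b ts ᗮ = atom k f (not b) ts
(A ∧' B) ᗮ = A ∧' B
(A ∨' B) ᗮ = A ∨' B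
(A ⇒ B) ᗮ = A ⇒ B
∀' A ᗮ = ∀' A
∃' A ᗮ = ∃' A

data IsAtomic : Fm → Set where
  atomic : ∀ {k f b ts} → IsAtomic (atom k f b ts)

data NegProp : Fm → Set where
  np-atom : ∀ {k f b ts} → NegProp (atom k f b ts)
  np-∧ : ∀ {A B} → NegProp A → NegProp B → NegProp (A ∧' B)
  np-⇒ : ∀ {A B} → NegProp A → NegProp B → NegProp (A ⇒ B)

data SimplyUniversal : Fm → Set where
  su-base : ∀ {P} → NegProp P → SimplyUniversal P
  su-∀    : ∀ {A} → SimplyUniversal A → SimplyUniversal (∀' A)

subT : (ℕ → Tm) → Tm → Tm
subT σ (var i) = σ i
subT σ `0 = `0
subT σ (S t) = S (subT σ t)

wkT : Tm → Tm
wkT = subT (λ i → var (suc i))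

liftσ : (ℕ → Tm) → ℕ → Tm
liftσ σ zero = var zero
liftσ σ (suc i) = wkT (σ i)

subF : (ℕ → Tm) → Fm → Fm
subF σ (atom k f b ts) = atom k f b (Vec.map (subT σ) ts)
subF σ (A ∧' B) = subF σ A ∧' subF σ B
subF σ (A ∨' B) = subF σ A ∨' subF σ B
subF σ (A ⇒ B) = subF σ A ⇒ subF σ B
subF σ (∀' A) = ∀' (subF (liftσ σ) A)
subF σ (∃' A) = ∃' (subF (liftσ σ) A)

single : Tm → ℕ → Tm
single m zero = m
single m (suc i) = var i

infixl 8 _[_]
_[_] : Fm → Tm → Fm
A [ m ] = subF (single m) A

shiftF : Fm → Fm
shiftF = subF (λ i → var (suc i))

-- A(Sα) seen under the binder of α (index 0)
succ0 : ℕ → Tm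
succ0 zero = S (var zero)
succ0 (suc i) = var (suc i)

down : List ℕ → List ℕ
down [] = []
down (zero ∷ l) = down l
down (suc i ∷ l) = i ∷ down l

fvT : Tm → List ℕ
fvT (var i) = i ∷ []
fvT `0 = []
fvT (S t) = fvT t

fvTs : ∀ {k} → Vec Tm k → List ℕ
fvTs [] = []
fvTs (t ∷ ts) = fvT t ++ fvTs ts

fvF : Fm → List ℕ
fvF (atom k f b ts) = fvTs ts
fvF (A ∧' B) = fvF A ++ fvF B
fvF (A ∨' B) = fvF A ++ fvF B
fvF (A ⇒ B) = fvF A ++ fvF B
fvF (∀' A) = down (fvF A)
fvF (∃' A) = down (fvF A)

Closed : Fm → Set
Closed A = fvF A ≡ []

env-cons : ℕ → (ℕ → ℕ) → ℕ → ℕ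
env-cons n ρ zero = n
env-cons n ρ (suc i) = ρ i

⟦_⟧T : Tm → (ℕ → ℕ) → ℕ
⟦ var i ⟧T ρ = ρ i
⟦ `0 ⟧T ρ = 0
⟦ S t ⟧T ρ = suc (⟦ t ⟧T ρ)

⟦_⟧ : Fm → (ℕ → ℕ) → Set
⟦ atom k f true ts ⟧ ρ = eval f (Vec.map (λ t → ⟦ t ⟧T ρ) ts) ≡ 0
⟦ atom k f false ts ⟧ ρ = eval f (Vec.map (λ t → ⟦ t ⟧T ρ) ts) ≢ 0
⟦ A ∧' B ⟧ ρ = ⟦ A ⟧ ρ × ⟦ B ⟧ ρ
⟦ A ∨' B ⟧ ρ = Σ Bool λ { true → ⟦ A ⟧ ρ ; false → ⟦ B ⟧ ρ }
⟦ A ⇒ B ⟧ ρ = ⟦ A ⟧ ρ → ⟦ B ⟧ ρ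
⟦ ∀' A ⟧ ρ = (n : ℕ) → ⟦ A ⟧ (env-cons n ρ)
⟦ ∃' A ⟧ ρ = Σ ℕ λ n → ⟦ A ⟧ (env-cons n ρ)

-- truth of a closed formula (environment irrelevant)
True[_] : Fm → Set
True[ A ] = ⟦ A ⟧ (λ _ → 0)

-- Proof terms of HA + EM₁⁻ (proof variables x and hypothesis variables a
-- are names ∈ ℕ, in separate namespaces; arithmetic variables bound by
-- λα and t[(α,x).u] are de Bruijn index 0 in the body)

data Pf : Set where
  pvar   : ℕ → Pf
  app    : Pf → Pf → Pf
  appT   : Pf → Tm → Pf
  lam    : ℕ → Pf → Pf
  lamT   : Pf → Pf
  pair   : Pf → Pf → Pf
  π₀     : Pf → Pf
  π₁     : Pf → Pf
  ι₀     : Pf → Pf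
  ι₁     : Pf → Pf
  case   : Pf → ℕ → Pf → ℕ → Pf → Pf    -- t[x.u,y.v]
  pack   : Tm → Pf → Pf
  unpack : Pf → ℕ → Pf → Pf             -- t[(α,x).u]
  par    : Pf → ℕ → Pf → Pf             -- u ∥_a v
  H      : ℕ → Fm → Pf                  -- H_a^{αP}  (P binds index 0)
  W      : ℕ → Fm → Pf
  True   : Pf
  R      : Pf → Pf → Tm → Pf
  post   : Pf → List Pf → Pf            -- r t₁ … tₙ  (n ≥ 1)

remove : ℕ → List ℕ → List ℕ
remove a = filter (λ b → ¬? (b ≟ a))

mutual
  fvP : Pf → List ℕ
  fvP (pvar x) = x ∷ []
  fvP (app t u) = fvP t ++ fvP u
  fvP (appT t m) = fvP t
  fvP (lam x u) = remove x (fvP u)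
  fvP (lamT u) = fvP u
  fvP (pair t u) = fvP t ++ fvP u
  fvP (π₀ u) = fvP u
  fvP (π₁ u) = fvP u
  fvP (ι₀ u) = fvP u
  fvP (ι₁ u) = fvP u
  fvP (case t x u y v) = fvP t ++ remove x (fvP u) ++ remove y (fvP v)
  fvP (pack m u) = fvP u
  fvP (unpack t x u) = fvP t ++ remove x (fvP u)
  fvP (par u a v) = fvP u ++ fvP v
  fvP (H a P) = []
  fvP (W a P) = []
  fvP True = []
  fvP (R u v m) = fvP u ++ fvP v
  fvP (post u us) = fvP u ++ fvPs us

  fvPs : List Pf → List ℕ
  fvPs [] = []
  fvPs (u ∷ us) = fvP u ++ fvPs us

mutual
  fvE : Pf → List ℕ
  fvE (pvar x) = []
  fvE (app t u) = fvE t ++ fvE u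
  fvE (appT t m) = fvE t
  fvE (lam x u) = fvE u
  fvE (lamT u) = fvE u
  fvE (pair t u) = fvE t ++ fvE u
  fvE (π₀ u) = fvE u
  fvE (π₁ u) = fvE u
  fvE (ι₀ u) = fvE u
  fvE (ι₁ u) = fvE u
  fvE (case t x u y v) = fvE t ++ fvE u ++ fvE v
  fvE (pack m u) = fvE u
  fvE (unpack t x u) = fvE t ++ fvE u
  fvE (par u a v) = remove a (fvE u ++ fvE v)
  fvE (H a P) = a ∷ []
  fvE (W a P) = a ∷ []
  fvE True = []
  fvE (R u v m) = fvE u ++ fvE v
  fvE (post u us) = fvE u ++ fvEs us

  fvEs : List Pf → List ℕ
  fvEs [] = []
  fvEs (u ∷ us) = fvE u ++ fvEs us

mutual
  fvA : Pf → List ℕ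
  fvA (pvar x) = []
  fvA (app t u) = fvA t ++ fvA u
  fvA (appT t m) = fvA t ++ fvT m
  fvA (lam x u) = fvA u
  fvA (lamT u) = down (fvA u)
  fvA (pair t u) = fvA t ++ fvA u
  fvA (π₀ u) = fvA u
  fvA (π₁ u) = fvA u
  fvA (ι₀ u) = fvA u
  fvA (ι₁ u) = fvA u
  fvA (case t x u y v) = fvA t ++ fvA u ++ fvA v
  fvA (pack m u) = fvT m ++ fvA u
  fvA (unpack t x u) = fvA t ++ down (fvA u)
  fvA (par u a v) = fvA u ++ fvA v
  fvA (H a P) = down (fvF P)
  fvA (W a P) = down (fvF P)
  fvA True = []
  fvA (R u v m) = fvA u ++ fvA v ++ fvT m
  fvA (post u us) = fvA u ++ fvAs us

  fvAs : List Pf → List ℕ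
  fvAs [] = []
  fvAs (u ∷ us) = fvA u ++ fvAs us

-- "all free variables of t are among zs (proof variables) and as
--  (hypothesis variables)": in particular no free arithmetic variable
FreeVarsAmong : Pf → List ℕ → List ℕ → Set
FreeVarsAmong t zs as = (fvP t ⊆ zs) × (fvE t ⊆ as) × (fvA t ≡ [])

-- Contexts (head = most recent declaration)

data Decl : Set where
  pv : ℕ → Fm → Decl
  ev : ℕ → Fm → Decl     -- a : ∀αP  or  a : ∃αP^⊥

Ctx : Set
Ctx = List Decl

shiftD : Decl → Decl
shiftD (pv x A) = pv x (shiftF A)
shiftD (ev a A) = ev a (shiftF A)

shiftC : Ctx → Ctx
shiftC = map shiftD

data _∋p_∶_ : Ctx → ℕ → Fm → Set where
  here    : ∀ {Γ x A} → (pv x A ∷ Γ) ∋p x ∶ A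
  there-p : ∀ {Γ x y A B} → x ≢ y → Γ ∋p x ∶ A → (pv y B ∷ Γ) ∋p x ∶ A
  there-e : ∀ {Γ x y A B} → Γ ∋p x ∶ A → (ev y B ∷ Γ) ∋p x ∶ A

data _∋e_∶_ : Ctx → ℕ → Fm → Set where
  here    : ∀ {Γ a A} → (ev a A ∷ Γ) ∋e a ∶ A
  there-e : ∀ {Γ a b A B} → a ≢ b → Γ ∋e a ∶ A → (ev b B ∷ Γ) ∋e a ∶ A
  there-p : ∀ {Γ a y A B} → Γ ∋e a ∶ A → (pv y B ∷ Γ) ∋e a ∶ A

-- Typing, parametrised by the set of Post rules
-- (PostRule As A : "A₁ … Aₙ / A is a Post rule")

module Typing (PostRule : List Fm → Fm → Set) where

  infix 2 _⊢_∶_ _⊢*_∶_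
  mutual
    data _⊢_∶_ : Ctx → Pf → Fm → Set where
      ax   : ∀ {Γ x A} → Γ ∋p x ∶ A → Γ ⊢ pvar x ∶ A
      ∧I   : ∀ {Γ u v A B} → Γ ⊢ u ∶ A → Γ ⊢ v ∶ B → Γ ⊢ pair u v ∶ A ∧' B
      ∧E₀  : ∀ {Γ u A B} → Γ ⊢ u ∶ A ∧' B → Γ ⊢ π₀ u ∶ A
      ∧E₁  : ∀ {Γ u A B} → Γ ⊢ u ∶ A ∧' B → Γ ⊢ π₁ u ∶ B
      ⇒I   : ∀ {Γ x u A B} → (pv x A ∷ Γ) ⊢ u ∶ B → Γ ⊢ lam x u ∶ A ⇒ B
      ⇒E   : ∀ {Γ t u A B} → Γ ⊢ t ∶ A ⇒ B → Γ ⊢ u ∶ A → Γ ⊢ app t u ∶ B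
      ∨I₀  : ∀ {Γ u A B} → Γ ⊢ u ∶ A → Γ ⊢ ι₀ u ∶ A ∨' B
      ∨I₁  : ∀ {Γ u A B} → Γ ⊢ u ∶ B → Γ ⊢ ι₁ u ∶ A ∨' B
      ∨E   : ∀ {Γ u x w₁ y w₂ A B C} → Γ ⊢ u ∶ A ∨' B →
             (pv x A ∷ Γ) ⊢ w₁ ∶ C → (pv y B ∷ Γ) ⊢ w₂ ∶ C →
             Γ ⊢ case u x w₁ y w₂ ∶ C
      ∀I   : ∀ {Γ u A} → shiftC Γ ⊢ u ∶ A → Γ ⊢ lamT u ∶ ∀' A
      ∀E   : ∀ {Γ u A m} → Γ ⊢ u ∶ ∀' A → Γ ⊢ appT u m ∶ A [ m ]
      ∃I   : ∀ {Γ u A m} → Γ ⊢ u ∶ A [ m ] → Γ ⊢ pack m u ∶ ∃' A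
      ∃E   : ∀ {Γ u x t A C} → Γ ⊢ u ∶ ∃' A →
             (pv x A ∷ shiftC Γ) ⊢ t ∶ shiftF C → Γ ⊢ unpack u x t ∶ C
      Hax  : ∀ {Γ a A} → Γ ∋e a ∶ ∀' A → Γ ⊢ H a A ∶ ∀' A
      Wax  : ∀ {Γ a P} → IsAtomic P → Γ ∋e a ∶ ∃' (P ᗮ) → Γ ⊢ W a P ∶ ∃' (P ᗮ)
      ind  : ∀ {Γ u v A m} → Γ ⊢ u ∶ A [ `0 ] →
             Γ ⊢ v ∶ ∀' (A ⇒ subF succ0 A) → Γ ⊢ R u v m ∶ A [ m ]
      postI : ∀ {Γ u us B Bs A} → IsAtomic A → IsAtomic B → AllAtomic Bs →
             Γ ⊢ u ∶ B → Γ ⊢* us ∶ Bs → PostRule (B ∷ Bs) A →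
             Γ ⊢ post u us ∶ A
      trueI : ∀ {Γ A} → IsAtomic A → PostRule [] A → Γ ⊢ True ∶ A
      em   : ∀ {Γ u a v P Q} → IsAtomic P → NegProp Q →
             (ev a (∀' P) ∷ Γ) ⊢ u ∶ ∃' Q →
             (ev a (∃' (P ᗮ)) ∷ Γ) ⊢ v ∶ ∃' Q →
             Γ ⊢ par u a v ∶ ∃' Q

    data _⊢*_∶_ : Ctx → List Pf → List Fm → Set where
      []  : ∀ {Γ} → Γ ⊢* [] ∶ []
      _∷_ : ∀ {Γ u us A As} → Γ ⊢ u ∶ A → Γ ⊢* us ∶ As → Γ ⊢* (u ∷ us) ∶ (A ∷ As)

    data AllAtomic : List Fm → Set where
      []  : AllAtomic []
      _∷_ : ∀ {A As} → IsAtomic A → AllAtomic As → AllAtomic (A ∷ As)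

data Frame : Set where
  appL    : Pf → Frame
  appR    : Pf → Frame
  appTL   : Tm → Frame
  lamF    : ℕ → Frame
  lamTF   : Frame
  pairL   : Pf → Frame
  pairR   : Pf → Frame
  π₀F π₁F ι₀F ι₁F : Frame
  caseS   : ℕ → Pf → ℕ → Pf → Frame
  caseL   : Pf → ℕ → ℕ → Pf → Frame
  caseR   : Pf → ℕ → Pf → ℕ → Frame
  packF   : Tm → Frame
  unpackS : ℕ → Pf → Frame
  unpackB : Pf → ℕ → Frame
  parL    : ℕ → Pf → Frame
  parR    : Pf → ℕ → Frame
  RF₀     : Pf → Tm → Frame
  RF₁     : Pf → Tm → Frame
  postH   : List Pf → Frame
  postT   : Pf → List Pf → List Pf → Frame

plugF : Frame → Pf → Pf
plugF (appL u) s = app s u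
plugF (appR t) s = app t s
plugF (appTL m) s = appT s m
plugF (lamF x) s = lam x s
plugF lamTF s = lamT s
plugF (pairL u) s = pair s u
plugF (pairR t) s = pair t s
plugF π₀F s = π₀ s
plugF π₁F s = π₁ s
plugF ι₀F s = ι₀ s
plugF ι₁F s = ι₁ s
plugF (caseS x u y v) s = case s x u y v
plugF (caseL t x y v) s = case t x s y v
plugF (caseR t x u y) s = case t x u y s
plugF (packF m) s = pack m s
plugF (unpackS x u) s = unpack s x u
plugF (unpackB t x) s = unpack t x s
plugF (parL a v) s = par s a v
plugF (parR u a) s = par u a s
plugF (RF₀ v m) s = R s v m
plugF (RF₁ u m) s = R u s m
plugF (postH us) s = post s us
plugF (postT t us vs) s = post t (us ++ s ∷ vs)

-- a context is a list of frames, innermost frame first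
plug : List Frame → Pf → Pf
plug [] s = s
plug (f ∷ C) s = plug C (plugF f s)

boundE : List Frame → List ℕ
boundE [] = []
boundE (parL a v ∷ C) = a ∷ boundE C
boundE (parR u a ∷ C) = a ∷ boundE C
boundE (_ ∷ C) = boundE C

data Redex : Pf → Set where
  r-β    : ∀ {x u t} → Redex (app (lam x u) t)
  r-βT   : ∀ {u m} → Redex (appT (lamT u) m)
  r-π₀   : ∀ {u v} → Redex (π₀ (pair u v))
  r-π₁   : ∀ {u v} → Redex (π₁ (pair u v))
  r-ι₀   : ∀ {u x t₀ y t₁} → Redex (case (ι₀ u) x t₀ y t₁)
  r-ι₁   : ∀ {u x t₀ y t₁} → Redex (case (ι₁ u) x t₀ y t₁)
  r-∃    : ∀ {m u x v} → Redex (unpack (pack m u) x v)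
  r-R0   : ∀ {u v} → Redex (R u v `0)
  r-RS   : ∀ {u v n} → Numeral n → Redex (R u v (S n))
  -- u ∥_a v ↦ u  if a is not free in u
  r-par₀ : ∀ {u a v} → a ∉ fvE u → Redex (par u a v)
  -- u ∥_a v ↦ v[a:=n]  if H_a^{αP} n occurs (free) in u, P[n/α] closed and false
  r-par₁ : ∀ {u a v n P} (C : List Frame) → Numeral n →
           u ≡ plug C (appT (H a P) n) → a ∉ boundE C →
           Closed (P [ n ]) → ¬ True[ P [ n ] ] → Redex (par u a v)
  -- H_a^{αP} n ↦ True  if P[n/α] closed and true
  r-H    : ∀ {a P n} → Numeral n → Closed (P [ n ]) → True[ P [ n ] ] →
           Redex (appT (H a P) n)

Normal : Pf → Set
Normal t = (C : List Frame) (s : Pf) → t ≡ plug C s → ¬ Redex s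

-- Γ = z₁:P₁,…,zₙ:Pₙ, a₁:∀α₁A₁,…,aₘ:∀αₘAₘ  (rightmost = most recent)

ctxOf : List (ℕ × Fm) → List (ℕ × Fm) → Ctx
ctxOf zs as = reverse (map (λ p → pv (proj₁ p) (proj₂ p)) zs
                    ++ map (λ p → ev (proj₁ p) (∀' (proj₂ p))) as)

-- A closed normal term t typed in such a context contains no λα, no case,
-- unpack or R and no ∥.  Indeed a neutral term has a simply universal type,
-- read off from the hypothesis at its head, so the major premise of a ∨- or
-- ∃-elimination would be an introduction, i.e. a redex; and closedness makes
-- every argument of R or of a ∀-elimination a numeral.  Such "canonical" terms
-- apply each H to a numeral.  Finally an ∥ cannot occur: its left branch is
-- canonical, so the bound hypothesis a is either not free there, or occurs as
-- H_a n with P[n/α] atomic, hence decidable, and either way the ∥ reduces.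

module Submission where

open import Defs
open import Data.Nat using (ℕ; zero; suc; _≟_)
open import Data.Vec using (Vec; []; _∷_)
import Data.Vec as Vec
open import Data.List using (List; []; _∷_; _++_; map)
open import Data.List.Properties using (++-assoc; ++-conicalˡ; ++-conicalʳ)
open import Data.List.Relation.Unary.All as All using (All; []; _∷_)
import Data.List.Relation.Unary.All.Properties as Allₚ
import Data.List.Relation.Unary.Any.Properties as Anyₚ
open import Data.List.Relation.Unary.Any using (here)
open import Data.List.Membership.Propositional using (_∈_; _∉_)
open import Data.List.Membership.Propositional.Properties using (∈-++⁻; ∈-∃++)
open import Data.List.Membership.DecPropositional _≟_ using (_∈?_)
open import Data.Product using (Σ; _×_; _,_; proj₁; proj₂)
open import Data.Sum using (_⊎_; inj₁; inj₂; [_,_]′; map₂)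
open import Data.Empty using (⊥; ⊥-elim)
open import Data.Unit using (⊤; tt)
open import Data.Bool using (true; false)
open import Function using (id; _∘_; case_of_)
open import Relation.Nullary using (¬_; Dec; yes; no; ¬?)
open import Relation.Binary.PropositionalEquality using (_≡_; _≢_; refl; sym; trans; cong; cong₂; subst)

private variable
  Γ : Ctx
  t u v w w₁ w₂ : Pf
  us : List Pf
  Bs : List Fm
  a x y : ℕ
  m : Tm
  A B P Q T : Fm
  Hyp : ℕ → Fm → Set

NegProp-subF : ∀ σ → NegProp A → NegProp (subF σ A)
NegProp-subF σ np-atom = np-atom
NegProp-subF σ (np-∧ nA nB) = np-∧ (NegProp-subF σ nA) (NegProp-subF σ nB)
NegProp-subF σ (np-⇒ nA nB) = np-⇒ (NegProp-subF σ nA) (NegProp-subF σ nB)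

SimplyUniversal-subF : ∀ σ → SimplyUniversal A → SimplyUniversal (subF σ A)
SimplyUniversal-subF σ (su-base nA) = su-base (NegProp-subF σ nA)
SimplyUniversal-subF σ (su-∀ sA) = su-∀ (SimplyUniversal-subF (liftσ σ) sA)

atomic-negProp : IsAtomic A → NegProp A
atomic-negProp atomic = np-atom

IsForall : Fm → Set
IsForall (∀' _) = ⊤
IsForall _ = ⊥

data ExNegProp : Fm → Set where
  neg : NegProp A → ExNegProp A
  ex  : NegProp A → ExNegProp (∃' A)

exNegProp-not-forall : ExNegProp A → ¬ IsForall A
exNegProp-not-forall (neg np-atom) ()
exNegProp-not-forall (neg (np-∧ _ _)) ()
exNegProp-not-forall (neg (np-⇒ _ _)) ()
exNegProp-not-forall (ex _) ()

numeral-closed : Numeral m → fvT m ≡ []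
numeral-closed nz = refl
numeral-closed (ns n) = numeral-closed n

closed-numeral : ∀ m → fvT m ≡ [] → Numeral m
closed-numeral (var _) ()
closed-numeral `0 _ = nz
closed-numeral (S m) cm = ns (closed-numeral m cm)

down-++ : ∀ xs ys → down (xs ++ ys) ≡ down xs ++ down ys
down-++ [] ys = refl
down-++ (zero ∷ xs) ys = down-++ xs ys
down-++ (suc i ∷ xs) ys = cong (i ∷_) (down-++ xs ys)

closed-subT-single : ∀ t → fvT m ≡ [] → down (fvT t) ≡ [] → fvT (subT (single m) t) ≡ []
closed-subT-single (var zero) cm _ = cm
closed-subT-single (var (suc _)) _ ()
closed-subT-single `0 _ _ = refl
closed-subT-single (S t) cm ct = closed-subT-single t cm ct

closed-subTs-single : ∀ {k} (ts : Vec Tm k) → fvT m ≡ [] → down (fvTs ts) ≡ [] →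
                      fvTs (Vec.map (subT (single m)) ts) ≡ []
closed-subTs-single [] _ _ = refl
closed-subTs-single (t ∷ ts) cm cts =
  cong₂ _++_ (closed-subT-single t cm (++-conicalˡ _ _ cts′))
             (closed-subTs-single ts cm (++-conicalʳ _ _ cts′))
  where cts′ = trans (sym (down-++ (fvT t) (fvTs ts))) cts

atom? : ∀ {k} (p : PR k) b (ts : Vec Tm k) ρ → Dec (⟦ atom k p b ts ⟧ ρ)
atom? p true ts ρ = eval p (Vec.map (λ t → ⟦ t ⟧T ρ) ts) ≟ 0
atom? p false ts ρ = ¬? (eval p (Vec.map (λ t → ⟦ t ⟧T ρ) ts) ≟ 0)

plug-++ : ∀ C D s → plug (C ++ D) s ≡ plug D (plug C s)
plug-++ [] D s = refl
plug-++ (f ∷ C) D s = plug-++ C D (plugF f s)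

normal⁻ : ∀ f → Normal (plugF f t) → Normal t
normal⁻ f N C s eq = N (C ++ f ∷ []) s (trans (cong (plugF f) eq) (sym (plug-++ C (f ∷ []) s)))

normal-redex : Normal t → ¬ Redex t
normal-redex N = N [] _ refl

normal-args : Normal (post u us) → All Normal us
normal-args {u = u} N = All.tabulate λ w∈us →
  let ys , zs , eq = ∈-∃++ w∈us in
  normal⁻ (postT u ys zs) (subst (λ ws → Normal (post u ws)) eq N)

no-R : ∀ m → fvT m ≡ [] → ¬ Normal (R u v m)
no-R m cm N with closed-numeral m cm
... | nz = normal-redex N r-R0
... | ns n = normal-redex N (r-RS n)

data GoodDecl : Decl → Set where
  pv : NegProp A → GoodDecl (pv x A)
  ev : SimplyUniversal A → GoodDecl (ev a (∀' A))

Good : Ctx → Set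
Good = All GoodDecl

lookup-pv : Good Γ → Γ ∋p x ∶ A → NegProp A
lookup-pv (pv nA ∷ _) here = nA
lookup-pv (_ ∷ g) (there-p _ l) = lookup-pv g l
lookup-pv (_ ∷ g) (there-e l) = lookup-pv g l

lookup-ev : Good Γ → Γ ∋e a ∶ A → SimplyUniversal A
lookup-ev (ev sA ∷ _) here = su-∀ sA
lookup-ev (_ ∷ g) (there-e _ l) = lookup-ev g l
lookup-ev (_ ∷ g) (there-p l) = lookup-ev g l

no-W : Good Γ → ¬ Γ ∋e a ∶ ∃' A
no-W g l with lookup-ev g l
... | su-base ()

∋e-pv⁻ : (pv x A ∷ Γ) ∋e a ∶ B → Γ ∋e a ∶ B
∋e-pv⁻ (there-p l) = l

hyp-atomic : IsAtomic P → (ev a (∀' P) ∷ Γ) ∋e a ∶ ∀' B → IsAtomic B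
hyp-atomic atP here = atP
hyp-atomic _ (there-e a≢a _) = ⊥-elim (a≢a refl)

Covers : (ℕ → Fm → Set) → Ctx → Set
Covers Hyp Γ = ∀ {a B} → Γ ∋e a ∶ ∀' B → Hyp a B

good-ctxOf : ∀ zs as → All (NegProp ∘ proj₂) zs → All (SimplyUniversal ∘ proj₂) as →
             Good (ctxOf zs as)
good-ctxOf zs as nzs sas = All.tabulate (All.lookup decls ∘ Anyₚ.reverse⁻)
  where decls = Allₚ.++⁺ (Allₚ.map⁺ (All.map pv nzs)) (Allₚ.map⁺ (All.map ev sas))

Neutral : Pf → Set
Neutral (lam _ _) = ⊥
Neutral (lamT _) = ⊥
Neutral (pair _ _) = ⊥
Neutral (ι₀ _) = ⊥
Neutral (ι₁ _) = ⊥
Neutral (pack _ _) = ⊥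
Neutral _ = ⊤

data Intro : Fm → Pf → Set where
  ⇒-intro  : Intro (A ⇒ B) (lam x u)
  ∀-intro  : Intro (∀' A) (lamT u)
  ∧-intro  : Intro (A ∧' B) (pair t u)
  ∨-intro₀ : Intro (A ∨' B) (ι₀ u)
  ∨-intro₁ : Intro (A ∨' B) (ι₁ u)
  ∃-intro  : Intro (∃' A) (pack m u)

-- The shape of the normal forms in question: no binder of arithmetic or
-- hypothesis variables, and every H applied to a numeral.  Hyp records what
-- is known about the hypothesis behind each H.
module _ (Hyp : ℕ → Fm → Set) where
  mutual
    data Canonical : Pf → Set where
      pvar : Canonical (pvar x)
      app  : Canonical t → Canonical u → Canonical (app t u)
      appT : CanonicalHead t → Numeral m → Canonical (appT t m)
      lam  : Canonical u → Canonical (lam x u)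
      pair : Canonical t → Canonical u → Canonical (pair t u)
      π₀   : Canonical u → Canonical (π₀ u)
      π₁   : Canonical u → Canonical (π₁ u)
      pack : Canonical u → Canonical (pack m u)
      True : Canonical True
      post : Canonical u → All Canonical us → Canonical (post u us)

    data CanonicalHead : Pf → Set where
      canonical : Canonical t → CanonicalHead t
      hyp : Hyp a A → down (fvF A) ≡ [] → CanonicalHead (H a A)

canonical-plugF : ∀ f → CanonicalHead Hyp (plugF f t) →
                  Canonical Hyp t ⊎ Σ Tm λ m → f ≡ appTL m × Numeral m × CanonicalHead Hyp t
canonical-plugF (appL _) (canonical (app c _)) = inj₁ c
canonical-plugF (appR _) (canonical (app _ c)) = inj₁ c
canonical-plugF (appTL m) (canonical (appT h n)) = inj₂ (m , refl , n , h)
canonical-plugF (lamF _) (canonical (lam c)) = inj₁ c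
canonical-plugF lamTF (canonical ())
canonical-plugF (pairL _) (canonical (pair c _)) = inj₁ c
canonical-plugF (pairR _) (canonical (pair _ c)) = inj₁ c
canonical-plugF π₀F (canonical (π₀ c)) = inj₁ c
canonical-plugF π₁F (canonical (π₁ c)) = inj₁ c
canonical-plugF ι₀F (canonical ())
canonical-plugF ι₁F (canonical ())
canonical-plugF (caseS _ _ _ _) (canonical ())
canonical-plugF (caseL _ _ _ _) (canonical ())
canonical-plugF (caseR _ _ _ _) (canonical ())
canonical-plugF (packF _) (canonical (pack c)) = inj₁ c
canonical-plugF (unpackS _ _) (canonical ())
canonical-plugF (unpackB _ _) (canonical ())
canonical-plugF (parL _ _) (canonical ())
canonical-plugF (parR _ _) (canonical ())
canonical-plugF (RF₀ _ _) (canonical ())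
canonical-plugF (RF₁ _ _) (canonical ())
canonical-plugF (postH _) (canonical (post c _)) = inj₁ c
canonical-plugF (postT _ us _) (canonical (post _ cs)) = inj₁ (All.head (Allₚ.++⁻ʳ us cs))

canonical-plug : ∀ C → Canonical Hyp (plug C t) →
                 Canonical Hyp t ⊎ Σ Tm λ m → Σ (List Frame) λ C′ →
                   C ≡ appTL m ∷ C′ × Numeral m × CanonicalHead Hyp t
canonical-plug [] c = inj₁ c
canonical-plug (f ∷ C) c =
  map₂ (λ (m , f≡ , n , h) → m , C , cong (_∷ C) f≡ , n , h)
       (canonical-plugF f ([ canonical , (λ (_ , _ , _ , _ , h) → h) ]′ (canonical-plug C c)))

H-applied : ∀ C → Canonical Hyp (plug C (H a B)) →
            Σ Tm λ m → Σ (List Frame) λ C′ →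
              C ≡ appTL m ∷ C′ × Numeral m × Hyp a B × down (fvF B) ≡ []
H-applied C c with canonical-plug C c
... | inj₁ ()
... | inj₂ (_ , _ , _ , _ , canonical ())
... | inj₂ (m , C′ , eq , n , hyp h cB) = m , C′ , eq , n , h , cB

Occurrence : ℕ → List Frame → Pf → Set
Occurrence a D t =
  Σ (List Frame) λ C → Σ Fm λ B → plug D t ≡ plug C (H a B) × boundE C ≡ boundE D

mutual
  hyp-occurs : Canonical Hyp u → a ∈ fvE u → ∀ D → Occurrence a D u
  hyp-occurs pvar () D
  hyp-occurs (app {t = t} {u = u} c₁ c₂) p D with ∈-++⁻ (fvE t) p
  ... | inj₁ q = hyp-occurs c₁ q (appL u ∷ D)
  ... | inj₂ q = hyp-occurs c₂ q (appR t ∷ D)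
  hyp-occurs (appT {m = m} h _) p D = hyp-occurs-head h p (appTL m ∷ D)
  hyp-occurs (lam {x = x} c) p D = hyp-occurs c p (lamF x ∷ D)
  hyp-occurs (pair {t = t} {u = u} c₁ c₂) p D with ∈-++⁻ (fvE t) p
  ... | inj₁ q = hyp-occurs c₁ q (pairL u ∷ D)
  ... | inj₂ q = hyp-occurs c₂ q (pairR t ∷ D)
  hyp-occurs (π₀ c) p D = hyp-occurs c p (π₀F ∷ D)
  hyp-occurs (π₁ c) p D = hyp-occurs c p (π₁F ∷ D)
  hyp-occurs (pack {m = m} c) p D = hyp-occurs c p (packF m ∷ D)
  hyp-occurs True () D
  hyp-occurs (post {u = u} {us = us} c cs) p D with ∈-++⁻ (fvE u) p
  ... | inj₁ q = hyp-occurs c q (postH us ∷ D)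
  ... | inj₂ q = hyp-occurs-args [] cs q D

  hyp-occurs-head : CanonicalHead Hyp u → a ∈ fvE u → ∀ D → Occurrence a D u
  hyp-occurs-head (canonical c) p D = hyp-occurs c p D
  hyp-occurs-head (hyp _ _) (here refl) D = D , _ , refl , refl

  hyp-occurs-args : ∀ pre → All (Canonical Hyp) us → a ∈ fvEs us → ∀ D →
                    Occurrence a D (post u (pre ++ us))
  hyp-occurs-args {us = w ∷ ws} {u = u} pre (c ∷ cs) p D with ∈-++⁻ (fvE w) p
  ... | inj₁ q = hyp-occurs c q (postT u pre ws ∷ D)
  ... | inj₂ q = subst (λ vs → Occurrence _ D (post u vs)) (++-assoc pre (w ∷ []) ws)
                   (hyp-occurs-args (pre ++ w ∷ []) cs q D)

par-not-normal : Canonical Hyp u → (∀ {B} → Hyp a B → IsAtomic B) → ¬ Normal (par u a v)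
par-not-normal {u = u} {a = a} {v = v} c atomic-hyp N with a ∈? fvE u
... | no a∉u = normal-redex N (r-par₀ a∉u)
... | yes a∈u with hyp-occurs c a∈u []
... | C , B , refl , bC with H-applied C c
... | m , C′ , refl , n , h , cB with atomic-hyp h
... | atomic {_} {p} {b} {ts}
  with atom? p b (Vec.map (subT (single m)) ts) (λ _ → 0) | closed-subTs-single ts (numeral-closed n) cB
... | yes holds | closed = normal⁻ (parL a v) N C′ _ refl (r-H n closed holds)
... | no fails | closed = normal-redex N (r-par₁ C′ n refl (subst (a ∉_) (sym bC) λ ()) closed fails)

module _ (PostRule : List Fm → Fm → Set) where
  open Typing PostRule

  neutral-or-intro : Γ ⊢ t ∶ T → Neutral t ⊎ Intro T t
  neutral-or-intro (ax _) = inj₁ tt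
  neutral-or-intro (∧I _ _) = inj₂ ∧-intro
  neutral-or-intro (∧E₀ _) = inj₁ tt
  neutral-or-intro (∧E₁ _) = inj₁ tt
  neutral-or-intro (⇒I _) = inj₂ ⇒-intro
  neutral-or-intro (⇒E _ _) = inj₁ tt
  neutral-or-intro (∨I₀ _) = inj₂ ∨-intro₀
  neutral-or-intro (∨I₁ _) = inj₂ ∨-intro₁
  neutral-or-intro (∨E _ _ _) = inj₁ tt
  neutral-or-intro (∀I _) = inj₂ ∀-intro
  neutral-or-intro (∀E _) = inj₁ tt
  neutral-or-intro (∃I _) = inj₂ ∃-intro
  neutral-or-intro (∃E _ _) = inj₁ tt
  neutral-or-intro (Hax _) = inj₁ tt
  neutral-or-intro (Wax _ _) = inj₁ tt
  neutral-or-intro (ind _ _) = inj₁ tt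
  neutral-or-intro (postI _ _ _ _ _ _) = inj₁ tt
  neutral-or-intro (trueI _ _) = inj₁ tt
  neutral-or-intro (em _ _ _ _) = inj₁ tt

  neutral-principal : Γ ⊢ u ∶ T → (Intro T u → Redex t) → Normal t → Neutral u
  neutral-principal d redex N with neutral-or-intro d
  ... | inj₁ nu = nu
  ... | inj₂ i = ⊥-elim (normal-redex N (redex i))

  head-canonical : Γ ⊢ t ∶ T → ¬ IsForall T → CanonicalHead Hyp t → Canonical Hyp t
  head-canonical _ _ (canonical c) = c
  head-canonical (Hax _) ¬∀ (hyp _ _) = ⊥-elim (¬∀ tt)

  mutual
    canonical-head : Good Γ → Covers Hyp Γ → Γ ⊢ t ∶ T → Normal t → fvA t ≡ [] →
                     ExNegProp T ⊎ Neutral t → CanonicalHead Hyp t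
    canonical-head g hs (ax _) _ _ _ = canonical pvar
    canonical-head g hs (∧I d₁ d₂) N z (inj₁ (neg (np-∧ nA nB))) =
      canonical (pair (canonical-exNeg g hs d₁ (normal⁻ (pairL _) N) (++-conicalˡ _ _ z) (neg nA))
                      (canonical-exNeg g hs d₂ (normal⁻ (pairR _) N) (++-conicalʳ _ _ z) (neg nB)))
    canonical-head g hs (∧E₀ d) N z _ =
      canonical (π₀ (head-canonical d id (canonical-head g hs d (normal⁻ π₀F N) z
        (inj₂ (neutral-principal d (λ { ∧-intro → r-π₀ }) N)))))
    canonical-head g hs (∧E₁ d) N z _ =
      canonical (π₁ (head-canonical d id (canonical-head g hs d (normal⁻ π₁F N) z
        (inj₂ (neutral-principal d (λ { ∧-intro → r-π₁ }) N)))))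
    canonical-head g hs (⇒I d) N z (inj₁ (neg (np-⇒ nA nB))) =
      canonical (lam (canonical-exNeg (pv nA ∷ g) (hs ∘ ∋e-pv⁻) d (normal⁻ (lamF _) N) z (neg nB)))
    canonical-head g hs (⇒E d₁ d₂) N z _
      with nt ← neutral-principal d₁ (λ { ⇒-intro → r-β }) N
      with su-base (np-⇒ nA _) ← neutral-type g d₁ (normal⁻ (appL _) N) (++-conicalˡ _ _ z) nt
      = canonical (app (head-canonical d₁ id
                          (canonical-head g hs d₁ (normal⁻ (appL _) N) (++-conicalˡ _ _ z) (inj₂ nt)))
                       (canonical-exNeg g hs d₂ (normal⁻ (appR _) N) (++-conicalʳ _ _ z) (neg nA)))
    canonical-head g hs (∨E d _ _) N z _ = ⊥-elim (no-case g d N (++-conicalˡ _ _ z))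
    canonical-head g hs (∀E {m = m} d) N z _ =
      canonical (appT (canonical-head g hs d (normal⁻ (appTL m) N) (++-conicalˡ _ _ z)
                        (inj₂ (neutral-principal d (λ { ∀-intro → r-βT }) N)))
                      (closed-numeral m (++-conicalʳ _ _ z)))
    canonical-head g hs (∃I {m = m} d) N z (inj₁ (ex nA)) =
      canonical (pack (canonical-exNeg g hs d (normal⁻ (packF m) N) (++-conicalʳ (fvT m) _ z)
                        (neg (NegProp-subF (single m) nA))))
    canonical-head g hs (∃E d _) N z _ = ⊥-elim (no-unpack g d N (++-conicalˡ _ _ z))
    canonical-head g hs (Hax l) _ z _ = hyp (hs l) z
    canonical-head g hs (Wax _ l) _ _ _ = ⊥-elim (no-W g l)
    canonical-head g hs (ind {u = u} {v = v} {m = m} _ _) N z _ =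
      ⊥-elim (no-R m (++-conicalʳ (fvA v) _ (++-conicalʳ (fvA u) _ z)) N)
    canonical-head g hs (postI {us = us} _ atB atBs d ds _) N z _ =
      canonical (post (canonical-exNeg g hs d (normal⁻ (postH us) N) (++-conicalˡ _ _ z)
                        (neg (atomic-negProp atB)))
                      (canonical-args g hs ds atBs (normal-args N) (++-conicalʳ _ _ z)))
    canonical-head g hs (trueI _ _) _ _ _ = canonical True
    canonical-head g hs (em atP nQ du _) N z _ = ⊥-elim (no-par g atP nQ du N z)
    canonical-head _ _ (∧I _ _) _ _ (inj₂ ())
    canonical-head _ _ (⇒I _) _ _ (inj₂ ())
    canonical-head _ _ (∨I₀ _) _ _ (inj₁ (neg ()))
    canonical-head _ _ (∨I₀ _) _ _ (inj₂ ())
    canonical-head _ _ (∨I₁ _) _ _ (inj₁ (neg ()))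
    canonical-head _ _ (∨I₁ _) _ _ (inj₂ ())
    canonical-head _ _ (∀I _) _ _ (inj₁ (neg ()))
    canonical-head _ _ (∀I _) _ _ (inj₂ ())
    canonical-head _ _ (∃I _) _ _ (inj₁ (neg ()))
    canonical-head _ _ (∃I _) _ _ (inj₂ ())

    canonical-exNeg : Good Γ → Covers Hyp Γ → Γ ⊢ t ∶ T → Normal t → fvA t ≡ [] →
                      ExNegProp T → Canonical Hyp t
    canonical-exNeg g hs d N z e =
      head-canonical d (exNegProp-not-forall e) (canonical-head g hs d N z (inj₁ e))

    canonical-args : Good Γ → Covers Hyp Γ → Γ ⊢* us ∶ Bs → AllAtomic Bs →
                     All Normal us → fvAs us ≡ [] → All (Canonical Hyp) us
    canonical-args g hs [] [] [] _ = []
    canonical-args g hs (d ∷ ds) (atB ∷ atBs) (N ∷ Ns) z =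
      canonical-exNeg g hs d N (++-conicalˡ _ _ z) (neg (atomic-negProp atB))
        ∷ canonical-args g hs ds atBs Ns (++-conicalʳ _ _ z)

    neutral-type : Good Γ → Γ ⊢ t ∶ T → Normal t → fvA t ≡ [] → Neutral t → SimplyUniversal T
    neutral-type g (ax l) _ _ _ = su-base (lookup-pv g l)
    neutral-type g (∧E₀ d) N z _
      with su-base (np-∧ nA _) ← neutral-type g d (normal⁻ π₀F N) z
                                   (neutral-principal d (λ { ∧-intro → r-π₀ }) N)
      = su-base nA
    neutral-type g (∧E₁ d) N z _
      with su-base (np-∧ _ nB) ← neutral-type g d (normal⁻ π₁F N) z
                                   (neutral-principal d (λ { ∧-intro → r-π₁ }) N)
      = su-base nB
    neutral-type g (⇒E d _) N z _
      with su-base (np-⇒ _ nB) ← neutral-type g d (normal⁻ (appL _) N) (++-conicalˡ _ _ z)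
                                   (neutral-principal d (λ { ⇒-intro → r-β }) N)
      = su-base nB
    neutral-type g (∨E d _ _) N z _ = ⊥-elim (no-case g d N (++-conicalˡ _ _ z))
    neutral-type g (∀E {m = m} d) N z _
      with su-∀ sA ← neutral-type g d (normal⁻ (appTL m) N) (++-conicalˡ _ _ z)
                       (neutral-principal d (λ { ∀-intro → r-βT }) N)
      = SimplyUniversal-subF (single m) sA
    neutral-type g (∃E d _) N z _ = ⊥-elim (no-unpack g d N (++-conicalˡ _ _ z))
    neutral-type g (Hax l) _ _ _ = lookup-ev g l
    neutral-type g (Wax _ l) _ _ _ = ⊥-elim (no-W g l)
    neutral-type g (ind {u = u} {v = v} {m = m} _ _) N z _ =
      ⊥-elim (no-R m (++-conicalʳ (fvA v) _ (++-conicalʳ (fvA u) _ z)) N)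
    neutral-type g (postI atomic _ _ _ _ _) _ _ _ = su-base np-atom
    neutral-type g (trueI atomic _) _ _ _ = su-base np-atom
    neutral-type g (em atP nQ du _) N z _ = ⊥-elim (no-par g atP nQ du N z)

    no-case : Good Γ → Γ ⊢ u ∶ A ∨' B → Normal (case u x w₁ y w₂) → fvA u ≡ [] → ⊥
    no-case g d N z
      with neutral-type g d (normal⁻ (caseS _ _ _ _) N) z
             (neutral-principal d (λ { ∨-intro₀ → r-ι₀ ; ∨-intro₁ → r-ι₁ }) N)
    ... | su-base ()

    no-unpack : Good Γ → Γ ⊢ u ∶ ∃' A → Normal (unpack u x w) → fvA u ≡ [] → ⊥
    no-unpack g d N z
      with neutral-type g d (normal⁻ (unpackS _ _) N) z
             (neutral-principal d (λ { ∃-intro → r-∃ }) N)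
    ... | su-base ()

    no-par : Good Γ → IsAtomic P → NegProp Q → (ev a (∀' P) ∷ Γ) ⊢ u ∶ ∃' Q →
             Normal (par u a v) → fvA (par u a v) ≡ [] → ⊥
    no-par g atP nQ du N z =
      par-not-normal (canonical-exNeg (ev (su-base (atomic-negProp atP)) ∷ g) id du
                        (normal⁻ (parL _ _) N) (++-conicalˡ _ _ z) (ex nQ))
                     (hyp-atomic atP) N

proposition4p6 : (PostRule : List Fm → Fm → Set)
    (zs : List (ℕ × Fm)) (as : List (ℕ × Fm)) →
    All (λ d → NegProp (proj₂ d)) zs →
    All (λ d → SimplyUniversal (proj₂ d)) as →
    (P : Fm) → NegProp P → (t : Pf) →
    (Typing._⊢_∶_ PostRule (ctxOf zs as) t (∃' P)
      ⊎ Typing._⊢_∶_ PostRule (ctxOf zs as) t P) →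
    Normal t →
    FreeVarsAmong t (map proj₁ zs) (map proj₁ as) →
    ((a : ℕ) → a ∈ map proj₁ as → (C : List Frame) (B : Fm) →
       t ≡ plug C (H a B) → a ∉ boundE C →
       Σ Tm (λ m → Σ (List Frame) (λ C′ → C ≡ appTL m ∷ C′)))
    × ((u : Pf) (a : ℕ) (v : Pf) → t ≢ par u a v)
proposition4p6 PostRule zs as nzs sas P nP t ⊢t N (_ , _ , closed) =
  (λ a _ C B t≡ _ →
     let m , C′ , C≡ , _ = H-applied C (subst (Canonical _) t≡ c) in m , C′ , C≡) ,
  (λ u a v t≡ → case subst (Canonical _) t≡ c of λ ())
  where
  g : Good (ctxOf zs as)
  g = good-ctxOf zs as nzs sas
  c : Canonical (λ a B → ctxOf zs as ∋e a ∶ ∀' B) t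
  c = [ (λ d → canonical-exNeg PostRule g id d N closed (ex nP))
      , (λ d → canonical-exNeg PostRule g id d N closed (neg nP)) ]′ ⊢t
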